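{- Let $G=([\ell],\mathcal{E})$ be a simple graph. For $1\le k\le\ell$, $$f_k(G)=\#\{\pi\in\mathfrak{S}_\ell\mid \pi_1=\ell\text{ and }\pi\text{ has exactly }\ell-k\ \mathcal{A}\text{ -descents}\}.$$
   Context: For $\pi=\pi_1\dots\pi_\ell\in\mathfrak{S}_\ell$ (permutations of $[\ell]$ in one-line notation), $\pi$ has an $\mathcal{A}$-descent (w.r.t. $G$) at $i\in[\ell]$ if $\pi_i>\pi_{i+1}$ and $\{\pi_i,\pi_{i+1}\}\notin\mathcal{E}$ (i.e. it is an edge of the complement graph), where $\pi_{\ell+1}:=\pi_1$. For $0\le k\le\ell$, $f_k(G)=\frac1\ell\#\{\pi\in\mathfrak{S}_\ell\mid\pi\text{ has exactly }\ell-k\ \mathcal{A}\text{ -descents}\}$. -}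

module Defs where

open import Level using (0ℓ)
open import Data.Nat using (ℕ; zero; suc; _∸_)
open import Data.Nat.DivMod using (_mod_)
open import Data.Fin using (Fin; toℕ; _<_; _<?_)
open import Data.Fin.Properties using (all?; _≟_)
open import Data.Vec using (Vec; []; _∷_; lookup)
open import Data.List using (List; []; _∷_; [_]; map; concatMap; filter; length; allFin)
open import Data.Product using (_×_)
open import Data.Empty using (⊥)
open import Relation.Nullary using (¬_; Dec; yes; no; _×-dec_; ¬?; _→-dec_)
open import Relation.Binary.PropositionalEquality using (_≡_; _≢_)
import Data.Nat as ℕ

-- A simple graph on the vertex set [ℓ] (vertex j+1 of the paper is
-- represented by j : Fin ℓ; the order is preserved).
-- Edges: a decidable, symmetric, irreflexive relation.
record SimpleGraph (ℓ : ℕ) : Set₁ where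
  field
    Adj     : Fin ℓ → Fin ℓ → Set
    adj?    : ∀ i j → Dec (Adj i j)
    sym     : ∀ {i j} → Adj i j → Adj j i
    irrefl  : ∀ {i} → ¬ Adj i i

open SimpleGraph public

allVecs : {A : Set} → List A → (n : ℕ) → List (Vec A n)
allVecs xs zero    = [ [] ]
allVecs xs (suc n) = concatMap (λ x → map (x ∷_) (allVecs xs n)) xs

IsPerm : {ℓ : ℕ} → Vec (Fin ℓ) ℓ → Set
IsPerm {ℓ} v = ∀ (i j : Fin ℓ) → lookup v i ≡ lookup v j → i ≡ j

isPerm? : {ℓ : ℕ} → (v : Vec (Fin ℓ) ℓ) → Dec (IsPerm v)
isPerm? v = all? (λ i → all? (λ j → (lookup v i ≟ lookup v j) →-dec (i ≟ j)))

perms : (ℓ : ℕ) → List (Vec (Fin ℓ) ℓ)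
perms ℓ = filter isPerm? (allVecs (allFin ℓ) ℓ)

-- cyclic successor of a position: i ↦ i+1, with ℓ ↦ 1 (π_{ℓ+1} := π_1)
next : {ℓ : ℕ} → Fin ℓ → Fin ℓ
next {suc n} i = suc (toℕ i) mod suc n

ADescent : {ℓ : ℕ} → SimpleGraph ℓ → Vec (Fin ℓ) ℓ → Fin ℓ → Set
ADescent G v i = (lookup v (next i) < lookup v i) × ¬ Adj G (lookup v i) (lookup v (next i))

aDescent? : {ℓ : ℕ} (G : SimpleGraph ℓ) (v : Vec (Fin ℓ) ℓ) (i : Fin ℓ) → Dec (ADescent G v i)
aDescent? G v i = (lookup v (next i) <? lookup v i) ×-dec ¬? (adj? G (lookup v i) (lookup v (next i)))

numADescents : {ℓ : ℕ} → SimpleGraph ℓ → Vec (Fin ℓ) ℓ → ℕ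
numADescents {ℓ} G v = length (filter (aDescent? G v) (allFin ℓ))

-- #{π ∈ S_ℓ | π has exactly ℓ-k A-descents}  (this equals ℓ · f_k(G))
ℓ·f : {ℓ : ℕ} → SimpleGraph ℓ → ℕ → ℕ
ℓ·f {ℓ} G k = length (filter (λ v → numADescents G v ℕ.≟ (ℓ ∸ k)) (perms ℓ))

-- π_1 = ℓ  (the largest vertex is represented by the value ℓ-1 in Fin ℓ)
StartsWithMax : {ℓ : ℕ} → Vec (Fin ℓ) ℓ → Set
StartsWithMax {zero}  []      = ⊥
StartsWithMax {suc n} (x ∷ _) = toℕ x ≡ n

startsWithMax? : {ℓ : ℕ} → (v : Vec (Fin ℓ) ℓ) → Dec (StartsWithMax v)
startsWithMax? {zero}  []      = no (λ ())
startsWithMax? {suc n} (x ∷ _) = toℕ x ℕ.≟ n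

countMaxFirst : {ℓ : ℕ} → SimpleGraph ℓ → ℕ → ℕ
countMaxFirst {ℓ} G k =
  length (filter (λ v → startsWithMax? v ×-dec (numADescents G v ℕ.≟ (ℓ ∸ k))) (perms ℓ))

module Submission where

-- Let ρ be cyclic rotation of words, ρ(π₁π₂…π_ℓ) = π₂…π_ℓπ₁,
-- so (ρπ)ᵢ = π_{i+1} with indices read cyclically.  Since A-descents are
-- defined cyclically, ρ preserves the number of A-descents, and it maps
-- permutations to permutations.  For a rotation-invariant set P of
-- permutations let Pᵢ = {π ∈ P | πᵢ = ℓ}.  Every permutation contains ℓ
-- at exactly one position, so |P| = Σᵢ |Pᵢ|; and ρ maps P_{i+1} onto Pᵢ,
-- so all |Pᵢ| equal |P₁|.  Hence |P| = ℓ · |P₁|.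

open import Defs
open import Data.Nat using (ℕ; _≤_; _*_)
open import Relation.Binary.PropositionalEquality using (_≡_)

import Data.Nat as ℕ
open import Data.Nat using (zero; suc; _+_; _∸_)
open import Data.Nat.Properties
  using (+-comm; +-assoc; *-comm; *-assoc; *-zeroʳ; *-identityʳ; +-identityʳ; 1+n≰n; +-*-semiring)
open import Data.Nat.DivMod using (m<n⇒m%n≡m; n%n≡0)
open import Data.Fin using (Fin; toℕ; fromℕ; inject₁; punchOut) renaming (zero to fzero; suc to fsuc)
open import Data.Fin.Properties
  using (toℕ-injective; toℕ-fromℕ; toℕ-fromℕ<; toℕ-inject₁; inject₁ℕ<; punchOut-injective; injective⇒≤; any?)
  renaming (_≟_ to _≟ᶠ_)
open import Data.Vec using (Vec; []; _∷_; lookup; _∷ʳ_)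
open import Data.List using (List; []; _∷_; [_]; map; concatMap; filter; length; allFin; tabulate; _++_)
open import Data.Product using (_,_; ∃)
open import Data.Empty using (⊥-elim)
open import Function using (_∘_; id)
open import Function.Definitions using (Injective)
open import Function.Bundles using (_⇔_; mk⇔; Equivalence)
open import Relation.Nullary using (Dec; yes; no; _×-dec_)
open import Relation.Binary.PropositionalEquality using (_≢_; refl; trans; cong; cong₂; module ≡-Reasoning) renaming (sym to ≡-sym)
open import Algebra.Properties.Semiring.Sum +-*-semiring using (sum; sum-syntax; sum-cong-≗; sum-init-last; *-distribˡ-sum)

private variable
  A B : Set
  n : ℕ

𝟙 : {P : Set} → Dec P → ℕ
𝟙 (yes _) = 1
𝟙 (no _)  = 0

𝟙-cong : {P Q : Set} (p : Dec P) (q : Dec Q) → (P → Q) → (Q → P) → 𝟙 p ≡ 𝟙 q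
𝟙-cong (yes _) (yes _) _ _ = refl
𝟙-cong (yes x) (no ¬y) f _ = ⊥-elim (¬y (f x))
𝟙-cong (no ¬x) (yes y) _ g = ⊥-elim (¬x (g y))
𝟙-cong (no _)  (no _)  _ _ = refl

𝟙-× : {P Q : Set} (p : Dec P) (q : Dec Q) → 𝟙 (p ×-dec q) ≡ 𝟙 p * 𝟙 q
𝟙-× (yes _) (yes _) = refl
𝟙-× (yes _) (no _)  = refl
𝟙-× (no _)  (yes _) = refl
𝟙-× (no _)  (no _)  = refl

𝟙-guard : {P : Set} (p : Dec P) (x : ℕ) {s : ℕ} → (P → s ≡ 1) → 𝟙 p * x ≡ 𝟙 p * x * s
𝟙-guard (yes holds) x s≡1 rewrite s≡1 holds = ≡-sym (*-identityʳ (x + 0))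
𝟙-guard (no _)      x _                     = refl

sumOver : List A → (A → ℕ) → ℕ
sumOver []       f = 0
sumOver (x ∷ xs) f = f x + sumOver xs f

sumOver-cong : (xs : List A) {f g : A → ℕ} → (∀ x → f x ≡ g x) → sumOver xs f ≡ sumOver xs g
sumOver-cong []       f≗g = refl
sumOver-cong (x ∷ xs) f≗g = cong₂ _+_ (f≗g x) (sumOver-cong xs f≗g)

sumOver-++ : (xs ys : List A) (f : A → ℕ) → sumOver (xs ++ ys) f ≡ sumOver xs f + sumOver ys f
sumOver-++ []       ys f = refl
sumOver-++ (x ∷ xs) ys f = trans (cong (f x +_) (sumOver-++ xs ys f)) (≡-sym (+-assoc (f x) _ _))

sumOver-map : (xs : List A) (h : A → B) (f : B → ℕ) → sumOver (map h xs) f ≡ sumOver xs (f ∘ h)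
sumOver-map []       h f = refl
sumOver-map (x ∷ xs) h f = cong (f (h x) +_) (sumOver-map xs h f)

sumOver-concatMap : (xs : List A) (h : A → List B) (f : B → ℕ) →
  sumOver (concatMap h xs) f ≡ sumOver xs (λ x → sumOver (h x) f)
sumOver-concatMap []       h f = refl
sumOver-concatMap (x ∷ xs) h f =
  trans (sumOver-++ (h x) (concatMap h xs) f) (cong (sumOver (h x) f +_) (sumOver-concatMap xs h f))

sumOver-zero : (xs : List A) → sumOver xs (λ _ → 0) ≡ 0
sumOver-zero []       = refl
sumOver-zero (x ∷ xs) = sumOver-zero xs

sumOver-+ : (xs : List A) (f g : A → ℕ) → sumOver xs (λ x → f x + g x) ≡ sumOver xs f + sumOver xs g
sumOver-+ []       f g = refl
sumOver-+ (x ∷ xs) f g = begin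
  (f x + g x) + sumOver xs (λ y → f y + g y)    ≡⟨ cong (f x + g x +_) (sumOver-+ xs f g) ⟩
  (f x + g x) + (sumOver xs f + sumOver xs g)   ≡⟨ interchange (f x) (g x) _ _ ⟩
  (f x + sumOver xs f) + (g x + sumOver xs g)   ∎
  where
  open ≡-Reasoning
  interchange : ∀ a b c d → (a + b) + (c + d) ≡ (a + c) + (b + d)
  interchange a b c d = begin
    (a + b) + (c + d)  ≡⟨ +-assoc a b _ ⟩
    a + (b + (c + d))  ≡⟨ cong (a +_) (≡-sym (+-assoc b c d)) ⟩
    a + ((b + c) + d)  ≡⟨ cong (λ t → a + (t + d)) (+-comm b c) ⟩
    a + ((c + b) + d)  ≡⟨ cong (a +_) (+-assoc c b d) ⟩
    a + (c + (b + d))  ≡⟨ ≡-sym (+-assoc a c _) ⟩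
    (a + c) + (b + d)  ∎

sumOver-swap : (xs : List A) (ys : List B) (f : A → B → ℕ) →
  sumOver xs (λ x → sumOver ys (f x)) ≡ sumOver ys (λ y → sumOver xs (λ x → f x y))
sumOver-swap []       ys f = ≡-sym (sumOver-zero ys)
sumOver-swap (x ∷ xs) ys f = trans (cong (sumOver ys (f x) +_) (sumOver-swap xs ys f))
  (≡-sym (sumOver-+ ys (f x) (λ y → sumOver xs (λ x → f x y))))

sumOver-sum-swap : (xs : List A) (f : A → Fin n → ℕ) →
  sumOver xs (λ x → ∑[ i < n ] f x i) ≡ ∑[ i < n ] sumOver xs (λ x → f x i)
sumOver-sum-swap {n = zero}  xs f = sumOver-zero xs
sumOver-sum-swap {n = suc n} xs f = trans (sumOver-+ xs (λ x → f x fzero) (λ x → sum (f x ∘ fsuc)))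
  (cong (sumOver xs (λ x → f x fzero) +_) (sumOver-sum-swap xs (λ x → f x ∘ fsuc)))

sumOver-tabulate : (h : Fin n → A) (f : A → ℕ) → sumOver (tabulate h) f ≡ ∑[ i < n ] f (h i)
sumOver-tabulate {zero}  h f = refl
sumOver-tabulate {suc n} h f = cong (f (h fzero) +_) (sumOver-tabulate (h ∘ fsuc) f)

sumOver-allFin : (f : Fin n → ℕ) → sumOver (allFin n) f ≡ ∑[ i < n ] f i
sumOver-allFin = sumOver-tabulate id

length-filter : {P : A → Set} (P? : ∀ x → Dec (P x)) (xs : List A) →
  length (filter P? xs) ≡ sumOver xs (𝟙 ∘ P?)
length-filter P? [] = refl
length-filter P? (x ∷ xs) with P? x
... | yes _ = cong suc (length-filter P? xs)
... | no _  = length-filter P? xs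

sumOver-filter : {P : A → Set} (P? : ∀ x → Dec (P x)) (xs : List A) (f : A → ℕ) →
  sumOver (filter P? xs) f ≡ sumOver xs (λ x → 𝟙 (P? x) * f x)
sumOver-filter P? [] f = refl
sumOver-filter P? (x ∷ xs) f with P? x
... | yes _ = cong₂ _+_ (≡-sym (+-identityʳ (f x))) (sumOver-filter P? xs f)
... | no _  = sumOver-filter P? xs f

length-filter-filter : {P Q : A → Set} (P? : ∀ x → Dec (P x)) (Q? : ∀ x → Dec (Q x)) (xs : List A) →
  length (filter Q? (filter P? xs)) ≡ sumOver xs (λ x → 𝟙 (P? x) * 𝟙 (Q? x))
length-filter-filter P? Q? xs =
  trans (length-filter Q? (filter P? xs)) (sumOver-filter P? xs (𝟙 ∘ Q?))

∑-const : (n c : ℕ) → ∑[ i < n ] c ≡ n * c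
∑-const zero    c = refl
∑-const (suc n) c = cong (c +_) (∑-const n c)

∑-delta : (j : Fin n) → ∑[ i < n ] 𝟙 (i ≟ᶠ j) ≡ 1
∑-delta {suc n} fzero = cong suc (begin
  ∑[ i < n ] 𝟙 (fsuc i ≟ᶠ fzero)  ≡⟨ sum-cong-≗ {n} (λ i → 𝟙-cong (fsuc i ≟ᶠ fzero) (no id) (λ ()) (λ ())) ⟩
  ∑[ i < n ] 0                    ≡⟨ ∑-const n 0 ⟩
  n * 0                           ≡⟨ *-zeroʳ n ⟩
  0                               ∎)
  where open ≡-Reasoning
∑-delta {suc n} (fsuc j) = trans
  (sum-cong-≗ {n} (λ i → 𝟙-cong (fsuc i ≟ᶠ fsuc j) (i ≟ᶠ j) (λ { refl → refl }) (cong fsuc)))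
  (∑-delta j)

next-inject₁ : (j : Fin n) → next {suc n} (inject₁ j) ≡ fsuc j
next-inject₁ {n} j = toℕ-injective (begin
  toℕ (next (inject₁ j))           ≡⟨ toℕ-fromℕ< _ ⟩
  suc (toℕ (inject₁ j)) ℕ.% suc n  ≡⟨ m<n⇒m%n≡m (ℕ.s≤s (inject₁ℕ< j)) ⟩
  suc (toℕ (inject₁ j))            ≡⟨ cong suc (toℕ-inject₁ j) ⟩
  suc (toℕ j)                      ∎)
  where open ≡-Reasoning

next-fromℕ : (n : ℕ) → next {suc n} (fromℕ n) ≡ fzero
next-fromℕ n = toℕ-injective (begin
  toℕ (next (fromℕ n))           ≡⟨ toℕ-fromℕ< _ ⟩
  suc (toℕ (fromℕ n)) ℕ.% suc n  ≡⟨ cong (λ t → suc t ℕ.% suc n) (toℕ-fromℕ n) ⟩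
  suc n ℕ.% suc n                ≡⟨ n%n≡0 (suc n) ⟩
  0                              ∎)
  where open ≡-Reasoning

data InjectOrLast : Fin (suc n) → Set where
  inject : (j : Fin n) → InjectOrLast (inject₁ j)
  last   : InjectOrLast (fromℕ n)

injectOrLast : (i : Fin (suc n)) → InjectOrLast i
injectOrLast {zero}  fzero    = last
injectOrLast {suc n} fzero    = inject fzero
injectOrLast {suc n} (fsuc i) with injectOrLast i
... | inject j = inject (fsuc j)
... | last     = last

prev : Fin (suc n) → Fin (suc n)
prev {n} fzero = fromℕ n
prev (fsuc j)  = inject₁ j

next-prev : (i : Fin (suc n)) → next (prev i) ≡ i
next-prev {n} fzero = next-fromℕ n
next-prev (fsuc j)  = next-inject₁ j

prev-next : (i : Fin (suc n)) → prev (next i) ≡ i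
prev-next i with injectOrLast i
... | inject j rewrite next-inject₁ j = refl
... | last {n} rewrite next-fromℕ n   = refl

next-injective : {i j : Fin (suc n)} → next i ≡ next j → i ≡ j
next-injective {i = i} {j} eq = trans (≡-sym (prev-next i)) (trans (cong prev eq) (prev-next j))

sum-next : (f : Fin (suc n) → ℕ) → ∑[ i < suc n ] f (next i) ≡ ∑[ i < suc n ] f i
sum-next {n} f = begin
  ∑[ i < suc n ] f (next i)                      ≡⟨ sum-init-last (f ∘ next) ⟩
  ∑[ j < n ] f (next (inject₁ j)) + f (next (fromℕ n))
    ≡⟨ cong₂ _+_ (sum-cong-≗ {n} (cong f ∘ next-inject₁)) (cong f (next-fromℕ n)) ⟩
  ∑[ j < n ] f (fsuc j) + f fzero                ≡⟨ +-comm _ (f fzero) ⟩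
  ∑[ i < suc n ] f i                             ∎
  where open ≡-Reasoning

next-invariant⇒constant : (f : Fin (suc n) → A) → (∀ i → f (next i) ≡ f i) → ∀ i → f i ≡ f fzero
next-invariant⇒constant {n} f invariant i = reach (toℕ i) i refl
  where
  reach : (m : ℕ) (i : Fin (suc n)) → toℕ i ≡ m → f i ≡ f fzero
  reach zero    fzero    _  = refl
  reach (suc m) (fsuc j) eq = begin
    f (fsuc j)            ≡⟨ cong f (≡-sym (next-inject₁ j)) ⟩
    f (next (inject₁ j))  ≡⟨ invariant (inject₁ j) ⟩
    f (inject₁ j)         ≡⟨ reach m (inject₁ j) (trans (toℕ-inject₁ j) (cong ℕ.pred eq)) ⟩
    f fzero               ∎
    where open ≡-Reasoning

rotate : Vec A (suc n) → Vec A (suc n)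
rotate (x ∷ w) = w ∷ʳ x

lookup-∷ʳ-inject₁ : (w : Vec A n) (x : A) (j : Fin n) → lookup (w ∷ʳ x) (inject₁ j) ≡ lookup w j
lookup-∷ʳ-inject₁ (y ∷ w) x fzero    = refl
lookup-∷ʳ-inject₁ (y ∷ w) x (fsuc j) = lookup-∷ʳ-inject₁ w x j

lookup-∷ʳ-fromℕ : (w : Vec A n) (x : A) → lookup (w ∷ʳ x) (fromℕ n) ≡ x
lookup-∷ʳ-fromℕ []      x = refl
lookup-∷ʳ-fromℕ (y ∷ w) x = lookup-∷ʳ-fromℕ w x

lookup-rotate : (v : Vec A (suc n)) (i : Fin (suc n)) → lookup (rotate v) i ≡ lookup v (next i)
lookup-rotate (x ∷ w) i with injectOrLast i
... | inject j rewrite next-inject₁ j = lookup-∷ʳ-inject₁ w x j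
... | last {n} rewrite next-fromℕ n   = lookup-∷ʳ-fromℕ w x

-- The words of length m+1 are enumerated by extending the words of length m
-- at the end (the enumeration `allVecs` extends them at the front).
sumOver-allVecs-∷ʳ : (xs : List A) (n : ℕ) (g : Vec A (suc n) → ℕ) →
  sumOver (allVecs xs (suc n)) g ≡ sumOver (allVecs xs n) (λ w → sumOver xs (λ x → g (w ∷ʳ x)))
sumOver-allVecs-∷ʳ xs zero g = begin
  sumOver (concatMap (λ x → map (x ∷_) [ [] ]) xs) g  ≡⟨ sumOver-concatMap xs _ g ⟩
  sumOver xs (λ x → g (x ∷ []) + 0)                    ≡⟨ sumOver-cong xs (λ x → +-identityʳ _) ⟩
  sumOver xs (λ x → g (x ∷ []))                        ≡⟨ ≡-sym (+-identityʳ _) ⟩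
  sumOver xs (λ x → g (x ∷ [])) + 0                    ∎
  where open ≡-Reasoning
sumOver-allVecs-∷ʳ xs (suc n) g = begin
  sumOver (allVecs xs (2 + n)) g
    ≡⟨ sumOver-concatMap xs _ g ⟩
  sumOver xs (λ x → sumOver (map (x ∷_) (allVecs xs (suc n))) g)
    ≡⟨ sumOver-cong xs (λ x → sumOver-map (allVecs xs (suc n)) (x ∷_) g) ⟩
  sumOver xs (λ x → sumOver (allVecs xs (suc n)) (λ w → g (x ∷ w)))
    ≡⟨ sumOver-cong xs (λ x → sumOver-allVecs-∷ʳ xs n (λ w → g (x ∷ w))) ⟩
  sumOver xs (λ x → sumOver (allVecs xs n) (λ u → sumOver xs (λ y → g (x ∷ (u ∷ʳ y)))))
    ≡⟨ sumOver-cong xs (λ x → ≡-sym (sumOver-map (allVecs xs n) (x ∷_) _)) ⟩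
  sumOver xs (λ x → sumOver (map (x ∷_) (allVecs xs n)) (λ w → sumOver xs (λ y → g (w ∷ʳ y))))
    ≡⟨ ≡-sym (sumOver-concatMap xs _ _) ⟩
  sumOver (allVecs xs (suc n)) (λ w → sumOver xs (λ x → g (w ∷ʳ x)))
    ∎
  where open ≡-Reasoning

sumOver-allVecs-rotate : (xs : List A) (n : ℕ) (g : Vec A (suc n) → ℕ) →
  sumOver (allVecs xs (suc n)) (g ∘ rotate) ≡ sumOver (allVecs xs (suc n)) g
sumOver-allVecs-rotate xs n g = begin
  sumOver (allVecs xs (suc n)) (g ∘ rotate)                      ≡⟨ sumOver-concatMap xs _ _ ⟩
  sumOver xs (λ x → sumOver (map (x ∷_) (allVecs xs n)) (g ∘ rotate))
    ≡⟨ sumOver-cong xs (λ x → sumOver-map (allVecs xs n) (x ∷_) _) ⟩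
  sumOver xs (λ x → sumOver (allVecs xs n) (λ w → g (w ∷ʳ x)))  ≡⟨ sumOver-swap xs (allVecs xs n) _ ⟩
  sumOver (allVecs xs n) (λ w → sumOver xs (λ x → g (w ∷ʳ x)))  ≡⟨ ≡-sym (sumOver-allVecs-∷ʳ xs n g) ⟩
  sumOver (allVecs xs (suc n)) g                                 ∎
  where open ≡-Reasoning

isPerm-rotate : (v : Vec (Fin (suc n)) (suc n)) → IsPerm v → IsPerm (rotate v)
isPerm-rotate v perm i j eq = next-injective (perm (next i) (next j)
  (trans (≡-sym (lookup-rotate v i)) (trans eq (lookup-rotate v j))))

isPerm-rotate⁻ : (v : Vec (Fin (suc n)) (suc n)) → IsPerm (rotate v) → IsPerm v
isPerm-rotate⁻ v perm i j eq = begin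
  i                ≡⟨ ≡-sym (next-prev i) ⟩
  next (prev i)    ≡⟨ cong next (perm (prev i) (prev j) (begin
      lookup (rotate v) (prev i)  ≡⟨ lookup-rotate v (prev i) ⟩
      lookup v (next (prev i))    ≡⟨ cong (lookup v) (next-prev i) ⟩
      lookup v i                  ≡⟨ eq ⟩
      lookup v j                  ≡⟨ cong (lookup v) (≡-sym (next-prev j)) ⟩
      lookup v (next (prev j))    ≡⟨ ≡-sym (lookup-rotate v (prev j)) ⟩
      lookup (rotate v) (prev j)  ∎)) ⟩
  next (prev j)    ≡⟨ next-prev j ⟩
  j                ∎
  where open ≡-Reasoning

aDescent-transport : (G : SimpleGraph n) {v w : Vec (Fin n) n} {i j : Fin n} →
  lookup v i ≡ lookup w j → lookup v (next i) ≡ lookup w (next j) →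
  ADescent G v i → ADescent G w j
aDescent-transport G eq₁ eq₂ rewrite eq₁ | eq₂ = id

-- The number of A-descents is invariant under rotation: A-descents are defined
-- cyclically, and ρ shifts all positions by one.
numADescents-rotate : (G : SimpleGraph (suc n)) (v : Vec (Fin (suc n)) (suc n)) →
  numADescents G (rotate v) ≡ numADescents G v
numADescents-rotate {n} G v = begin
  length (filter (aDescent? G (rotate v)) (allFin (suc n)))
    ≡⟨ length-filter (aDescent? G (rotate v)) (allFin (suc n)) ⟩
  sumOver (allFin (suc n)) (λ i → 𝟙 (aDescent? G (rotate v) i))
    ≡⟨ sumOver-allFin (λ i → 𝟙 (aDescent? G (rotate v) i)) ⟩
  ∑[ i < suc n ] 𝟙 (aDescent? G (rotate v) i)
    ≡⟨ sum-cong-≗ {suc n} shifted ⟩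
  ∑[ i < suc n ] 𝟙 (aDescent? G v (next i))
    ≡⟨ sum-next (λ i → 𝟙 (aDescent? G v i)) ⟩
  ∑[ i < suc n ] 𝟙 (aDescent? G v i)
    ≡⟨ ≡-sym (sumOver-allFin (λ i → 𝟙 (aDescent? G v i))) ⟩
  sumOver (allFin (suc n)) (λ i → 𝟙 (aDescent? G v i))
    ≡⟨ ≡-sym (length-filter (aDescent? G v) (allFin (suc n))) ⟩
  length (filter (aDescent? G v) (allFin (suc n)))
    ∎
  where
  open ≡-Reasoning
  shifted : ∀ i → 𝟙 (aDescent? G (rotate v) i) ≡ 𝟙 (aDescent? G v (next i))
  shifted i = 𝟙-cong (aDescent? G (rotate v) i) (aDescent? G v (next i))
    (aDescent-transport G {rotate v} {v} (lookup-rotate v i) (lookup-rotate v (next i)))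
    (aDescent-transport G {v} {rotate v} (≡-sym (lookup-rotate v i)) (≡-sym (lookup-rotate v (next i))))

-- An injective map Fin n → Fin n is surjective (pigeonhole): otherwise, removing
-- a missed value c, it would inject Fin n into Fin (n - 1).
injective⇒surjective : (f : Fin n → Fin n) → Injective _≡_ _≡_ f → ∀ c → ∃ λ i → f i ≡ c
injective⇒surjective {suc n} f f-injective c with any? (λ i → f i ≟ᶠ c)
... | yes hit = hit
... | no miss = ⊥-elim (1+n≰n (injective⇒≤ {f = squeeze} squeeze-injective))
  where
  c≢f : ∀ i → c ≢ f i
  c≢f i eq = miss (i , ≡-sym eq)
  squeeze : Fin (suc n) → Fin n
  squeeze i = punchOut (c≢f i)
  squeeze-injective : Injective _≡_ _≡_ squeeze
  squeeze-injective {i} {j} eq = f-injective (punchOut-injective (c≢f i) (c≢f j) eq)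

∑-fiber : (f : Fin n → Fin n) → Injective _≡_ _≡_ f → ∀ c → ∑[ i < n ] 𝟙 (f i ≟ᶠ c) ≡ 1
∑-fiber {n} f f-injective c with injective⇒surjective f f-injective c
... | j , fj≡c = trans
  (sum-cong-≗ {n} (λ i → 𝟙-cong (f i ≟ᶠ c) (i ≟ᶠ j)
    (λ fi≡c → f-injective (trans fi≡c (≡-sym fj≡c))) (λ { refl → fj≡c })))
  (∑-delta j)

module CountByMaximum (n : ℕ) {Q : Vec (Fin (suc n)) (suc n) → Set} (Q? : ∀ v → Dec (Q v))
                      (Q-rotate : ∀ v → Q (rotate v) ⇔ Q v) where

  ℓ : ℕ
  ℓ = suc n

  words : List (Vec (Fin ℓ) ℓ)
  words = allVecs (allFin ℓ) ℓ

  inP : Vec (Fin ℓ) ℓ → ℕ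
  inP v = 𝟙 (isPerm? v) * 𝟙 (Q? v)

  maxAt : Vec (Fin ℓ) ℓ → Fin ℓ → ℕ
  maxAt v i = 𝟙 (toℕ (lookup v i) ℕ.≟ n)

  countAt : Fin ℓ → ℕ
  countAt i = sumOver words (λ v → inP v * maxAt v i)

  inP-rotate : (v : Vec (Fin ℓ) ℓ) → inP (rotate v) ≡ inP v
  inP-rotate v = cong₂ _*_
    (𝟙-cong (isPerm? (rotate v)) (isPerm? v) (isPerm-rotate⁻ v) (isPerm-rotate v))
    (𝟙-cong (Q? (rotate v)) (Q? v) (Equivalence.to (Q-rotate v)) (Equivalence.from (Q-rotate v)))

  maxAt-unique : (v : Vec (Fin ℓ) ℓ) → IsPerm v → ∑[ i < ℓ ] maxAt v i ≡ 1
  maxAt-unique v perm = trans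
    (sum-cong-≗ {ℓ} (λ i → 𝟙-cong (toℕ (lookup v i) ℕ.≟ n) (lookup v i ≟ᶠ fromℕ n)
      (λ eq → toℕ-injective (trans eq (≡-sym (toℕ-fromℕ n))))
      (λ eq → trans (cong toℕ eq) (toℕ-fromℕ n))))
    (∑-fiber (lookup v) (λ {i} {j} → perm i j) (fromℕ n))

  inP-split : (v : Vec (Fin ℓ) ℓ) → inP v ≡ inP v * ∑[ i < ℓ ] maxAt v i
  inP-split v = 𝟙-guard (isPerm? v) (𝟙 (Q? v)) (maxAt-unique v)

  -- ρ maps P_{i+1} bijectively onto Pᵢ.
  countAt-next : (i : Fin ℓ) → countAt (next i) ≡ countAt i
  countAt-next i = begin
    sumOver words (λ v → inP v * maxAt v (next i))
      ≡⟨ sumOver-cong words (λ v → cong₂ _*_ (≡-sym (inP-rotate v))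
           (cong (λ x → 𝟙 (toℕ x ℕ.≟ n)) (≡-sym (lookup-rotate v i)))) ⟩
    sumOver words (λ v → inP (rotate v) * maxAt (rotate v) i)
      ≡⟨ sumOver-allVecs-rotate (allFin ℓ) n (λ v → inP v * maxAt v i) ⟩
    sumOver words (λ v → inP v * maxAt v i)
      ∎
    where open ≡-Reasoning

  countAt-first : countAt fzero ≡ length (filter (λ v → startsWithMax? v ×-dec Q? v) (perms ℓ))
  countAt-first = ≡-sym (trans (length-filter-filter isPerm? (λ v → startsWithMax? v ×-dec Q? v) words)
    (sumOver-cong words rearrange))
    where
    rearrange : (v : Vec (Fin ℓ) ℓ) →
      𝟙 (isPerm? v) * 𝟙 (startsWithMax? v ×-dec Q? v) ≡ inP v * maxAt v fzero
    rearrange v@(x ∷ _) = begin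
      𝟙 (isPerm? v) * 𝟙 (startsWithMax? v ×-dec Q? v) ≡⟨ cong (𝟙 (isPerm? v) *_) (𝟙-× (startsWithMax? v) (Q? v)) ⟩
      𝟙 (isPerm? v) * (maxAt v fzero * 𝟙 (Q? v))      ≡⟨ cong (𝟙 (isPerm? v) *_) (*-comm (maxAt v fzero) _) ⟩
      𝟙 (isPerm? v) * (𝟙 (Q? v) * maxAt v fzero)      ≡⟨ ≡-sym (*-assoc (𝟙 (isPerm? v)) _ _) ⟩
      inP v * maxAt v fzero                            ∎
      where open ≡-Reasoning

  count-by-maximum : length (filter Q? (perms ℓ)) ≡ ℓ * length (filter (λ v → startsWithMax? v ×-dec Q? v) (perms ℓ))
  count-by-maximum = begin
    length (filter Q? (perms ℓ))                        ≡⟨ length-filter-filter isPerm? Q? words ⟩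
    sumOver words inP                                   ≡⟨ sumOver-cong words inP-split ⟩
    sumOver words (λ v → inP v * ∑[ i < ℓ ] maxAt v i)  ≡⟨ sumOver-cong words (λ v → *-distribˡ-sum (inP v) (maxAt v)) ⟩
    sumOver words (λ v → ∑[ i < ℓ ] (inP v * maxAt v i))  ≡⟨ sumOver-sum-swap words (λ v i → inP v * maxAt v i) ⟩
    ∑[ i < ℓ ] countAt i                                ≡⟨ sum-cong-≗ {ℓ} (next-invariant⇒constant countAt countAt-next) ⟩
    ∑[ i < ℓ ] countAt fzero                            ≡⟨ ∑-const ℓ (countAt fzero) ⟩
    ℓ * countAt fzero                                   ≡⟨ cong (ℓ *_) countAt-first ⟩
    ℓ * length (filter (λ v → startsWithMax? v ×-dec Q? v) (perms ℓ)) ∎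
    where open ≡-Reasoning

-- The proposition: take Q π = "π has exactly ℓ - k A-descents", which is
-- rotation invariant; ℓ = 0 is excluded by 1 ≤ k ≤ ℓ.
proposition3p6 : (ℓ : ℕ) (G : SimpleGraph ℓ) (k : ℕ) → 1 ≤ k → k ≤ ℓ →
    ℓ·f G k ≡ ℓ * countMaxFirst G k
proposition3p6 zero    G zero    ()  _
proposition3p6 zero    G (suc k) _   ()
proposition3p6 (suc n) G k       _   _  =
  CountByMaximum.count-by-maximum n (λ v → numADescents G v ℕ.≟ (suc n ∸ k))
    (λ v → mk⇔ (trans (≡-sym (numADescents-rotate G v))) (trans (numADescents-rotate G v)))
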